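{- Let $G$ and $H$ be graphs, with $H$ of order $n$. Then $$\mathcal{B}(G\cup H)=\sum_{k=1}^{n}S(H,k)\,\mathcal{B}(G\cup K_k)\quad\text{and}\quad \mathcal{T}(G\cup H)=\sum_{k=1}^{n}S(H,k)\,\mathcal{T}(G\cup K_k).$$
   Context: All graphs are finite, simple and undirected. A coloring of a graph $G$ assigns colors to its vertices so that adjacent vertices receive different colors; two colorings are equivalent if they induce the same partition of the vertex set into color classes. $S(G,k)$ denotes the number of non-equivalent colorings of $G$ using exactly $k$ colors; $\mathcal{B}(G)=\sum_{k\ge1}S(G,k)$ and $\mathcal{T}(G)=\sum_{k\ge1}kS(G,k)$. $\cup$ denotes disjoint union and $K_k$ the complete graph on $k$ vertices. -}

module Defs where

open import Data.Bool using (Bool; true; false; not; _∧_; if_then_else_)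
open import Data.Nat using (ℕ; zero; suc; _+_; _*_; _⊔_; _≤ᵇ_; _≡ᵇ_)
open import Data.Fin using (Fin; toℕ; splitAt; _≟_)
open import Data.Sum using (inj₁; inj₂)
open import Data.Vec using (Vec; []; _∷_; lookup)
open import Data.List using (List; []; _∷_; map; concatMap; length; filter; applyUpTo; allFin)
open import Data.Bool.ListAction using (all)
open import Data.Nat.ListAction using (sum)
open import Relation.Nullary.Decidable using (⌊_⌋)
open import Relation.Binary.PropositionalEquality using (_≡_)

Graph : ℕ → Set
Graph n = Fin n → Fin n → Bool

record IsSimple {n : ℕ} (G : Graph n) : Set where
  field
    symmetric   : ∀ i j → G i j ≡ G j i
    irreflexive : ∀ i → G i i ≡ false

_∪_ : {m n : ℕ} → Graph m → Graph n → Graph (m + n)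
_∪_ {m} G H i j with splitAt m i | splitAt m j
... | inj₁ a | inj₁ b = G a b
... | inj₂ a | inj₂ b = H a b
... | _      | _      = false

K : (k : ℕ) → Graph k
K k i j = not ⌊ i ≟ j ⌋

allColourings : (k n : ℕ) → List (Vec (Fin k) n)
allColourings k zero    = [] ∷ []
allColourings k (suc n) =
  concatMap (λ c → map (c ∷_) (allColourings k n)) (allFin k)

proper : {n k : ℕ} → Graph n → Vec (Fin k) n → Bool
proper {n} G c =
  all (λ i → all (λ j → not (G i j) Data.Bool.∨ not ⌊ lookup c i ≟ lookup c j ⌋) (allFin n)) (allFin n)

-- Restricted-growth condition: scanning the vertices in order with u = number
-- of colours used so far, each vertex gets an old colour or the next new one
-- (colour index ≤ u); at the end exactly k colours must have been used.
-- Such canonical colourings are in bijection with the partitions of the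
-- vertex set into exactly k nonempty classes (number the classes in order of
-- their least vertex), i.e. with colourings up to equivalence.
canonical : {n k : ℕ} → ℕ → Vec (Fin k) n → Bool
canonical {k = k} u []      = u ≡ᵇ k
canonical {k = k} u (x ∷ c) = (toℕ x ≤ᵇ u) ∧ canonical (u ⊔ suc (toℕ x)) c

S : {n : ℕ} → Graph n → ℕ → ℕ
S {n} G k = length (filter (λ c → T? (proper G c ∧ canonical 0 c)) (allColourings k n))
  where
  open import Data.Bool using (T?)

-- B(G) = Σ_{k ≥ 1} S(G,k)   (S(G,k) = 0 for k > n, so k ranges over 1..n)
𝓑 : {n : ℕ} → Graph n → ℕ
𝓑 {n} G = sum (map (S G) (applyUpTo suc n))

𝓣 : {n : ℕ} → Graph n → ℕ
𝓣 {n} G = sum (map (λ k → k * S G k) (applyUpTo suc n))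

{-# OPTIONS --safe #-}
module Submission where

-- Let P(G, x) be the number of proper colourings of G with colours 0, …, x - 1.
-- Sorting colourings by the partition they induce gives
-- P(G, x) = Σ_r S(G, r) x(x-1)⋯(x-r+1), and the falling factorials are
-- linearly independent, so S(G, -) is determined by P(G, -).  Since
-- P(G ∪ H) = P(G) P(H) and P(K_k, x) = x(x-1)⋯(x-k+1), expanding P(H) gives
-- P(G ∪ H) = Σ_k S(H, k) P(G ∪ K_k); comparing coefficients,
-- S(G ∪ H, j) = Σ_k S(H, k) S(G ∪ K_k, j), and summing over j with weights 1
-- and j gives both identities.

open import Defs

open import Algebra.Bundles using (CommutativeMonoid)
open import Data.Bool using (Bool; true; false; not; _∧_; _∨_; if_then_else_; T?)
open import Data.Bool.ListAction using (and; all)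
open import Data.Bool.Properties using (∧-commutativeMonoid; ∧-assoc; ∧-idem; ∧-identityʳ; ∧-zeroʳ)
open import Data.Fin using (Fin; zero; suc; toℕ; fromℕ<; _↑ˡ_; _↑ʳ_)
import Data.Fin.Properties as Fin
open import Data.Fin.Properties using (toℕ<n; toℕ-injective; toℕ-fromℕ<; splitAt-↑ˡ; splitAt-↑ʳ)
open import Data.Fin.Permutation using (transpose)
import Data.Fin.Permutation.Components as PC
open import Data.List using (List; []; _∷_; map; filter; length; concatMap; allFin; tabulate; applyUpTo; _++_)
open import Data.List.Properties using (length-++; filter-++; map-cong; map-tabulate)
open import Data.Nat using (ℕ; zero; suc; _+_; _*_; _∸_; _⊔_; _≤ᵇ_; _≡ᵇ_; _<_; _≤_; s≤s; z≤n; _≟_; _≤?_)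
open import Data.Nat.ListAction using (sum)
open import Data.Nat.Properties
  using (+-*-semiring; *-commutativeSemigroup; ≤-refl; ≤-trans; <-≤-trans; <⇒≤; <⇒≢; <⇒≱; ≤∧≢⇒<;
         n≤1+n; m<n⇒m<1+n; m≤m+n; m<m+n; +-monoʳ-≤; +-monoʳ-<; +-assoc; +-suc; +-identityʳ; +-cancelˡ-≡;
         *-comm; *-assoc; *-identityʳ; *-zeroʳ; *-distribʳ-+; *-cancelˡ-≡; m+[n∸m]≡n; m≥n⇒m⊔n≡m; m≤n⇒m⊔n≡n)
open import Data.Product using (_×_; _,_)
open import Data.Vec using (Vec; []; _∷_; lookup)
import Data.Vec as Vec
open import Data.Vec.Properties using (lookup-map; lookup-++ˡ; lookup-++ʳ)
open import Function.Bundles using (_⇔_; mk⇔)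
open import Relation.Binary.Definitions using (DecidableEquality)
open import Relation.Binary.PropositionalEquality
open import Relation.Nullary using (Dec; does; yes; no; ¬?; _×-dec_)
open import Relation.Nullary.Decidable using (⌊_⌋; does-⇔; dec-true; dec-false; isYes≗does; ⌊⌋-map′)

open import Algebra.Properties.Semiring.Sum +-*-semiring
  using (sum-cong-≗; sum-replicate-zero; ∑-comm; ∑-distrib-+; *-distribˡ-sum; *-distribʳ-sum; ∑-permute)
  renaming (sum to ∑)
open import Algebra.Properties.CommutativeMonoid.Sum ∧-commutativeMonoid
  using () renaming (sum to ⋀; sum-cong-≗ to ⋀-cong; ∑-distrib-+ to ⋀-distrib-∧; sum-replicate-zero to ⋀-true)
open import Algebra.Properties.CommutativeSemigroup *-commutativeSemigroup
  using () renaming (x∙yz≈y∙xz to x*[y*z]≡y*[x*z])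
open import Algebra.Properties.CommutativeSemigroup (CommutativeMonoid.commutativeSemigroup ∧-commutativeMonoid)
  using () renaming (xy∙z≈y∙xz to [x∧y]∧z≡y∧[x∧z])

Σ< : ℕ → (ℕ → ℕ) → ℕ
Σ< n f = ∑ {n} λ i → f (toℕ i)

infix 5 Σ<
syntax Σ< n (λ i → e) = Σ[ i < n ] e

Σ-cong : ∀ n {f g : ℕ → ℕ} → (∀ i → i < n → f i ≡ g i) → Σ< n f ≡ Σ< n g
Σ-cong n f≗g = sum-cong-≗ λ i → f≗g (toℕ i) (toℕ<n i)

Σ-zero : ∀ n {f : ℕ → ℕ} → (∀ i → i < n → f i ≡ 0) → Σ< n f ≡ 0
Σ-zero n f≗0 = trans (Σ-cong n f≗0) (sum-replicate-zero n)

Σ-const : ∀ n c → Σ[ _ < n ] c ≡ n * c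
Σ-const zero    c = refl
Σ-const (suc n) c = cong (c +_) (Σ-const n c)

Σ-split : ∀ a b (f : ℕ → ℕ) → Σ< (a + b) f ≡ Σ< a f + (Σ[ i < b ] f (a + i))
Σ-split zero    b f = refl
Σ-split (suc a) b f = trans (cong (f 0 +_) (Σ-split a b (λ i → f (suc i)))) (sym (+-assoc (f 0) _ _))

Σ-truncate : ∀ {a b} (f : ℕ → ℕ) → a ≤ b → (∀ i → a ≤ i → f i ≡ 0) → Σ< b f ≡ Σ< a f
Σ-truncate {a} {b} f a≤b vanish = begin
  Σ< b f
    ≡⟨ cong (λ n → Σ< n f) (m+[n∸m]≡n a≤b) ⟨
  Σ< (a + (b ∸ a)) f
    ≡⟨ Σ-split a (b ∸ a) f ⟩
  Σ< a f + (Σ[ i < b ∸ a ] f (a + i))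
    ≡⟨ cong (Σ< a f +_) (Σ-zero (b ∸ a) λ i _ → vanish (a + i) (m≤m+n a i)) ⟩
  Σ< a f + 0
    ≡⟨ +-identityʳ _ ⟩
  Σ< a f ∎
  where open ≡-Reasoning

Σ-comm : ∀ m n (f : ℕ → ℕ → ℕ) → (Σ[ i < m ] Σ[ j < n ] f i j) ≡ (Σ[ j < n ] Σ[ i < m ] f i j)
Σ-comm m n f = ∑-comm {m} {n} λ i j → f (toℕ i) (toℕ j)

Σ-distrib-+ : ∀ n (f g : ℕ → ℕ) → (Σ[ i < n ] (f i + g i)) ≡ Σ< n f + Σ< n g
Σ-distrib-+ n f g = ∑-distrib-+ {n} (λ i → f (toℕ i)) (λ i → g (toℕ i))

*-distribˡ-Σ : ∀ n c (f : ℕ → ℕ) → c * Σ< n f ≡ (Σ[ i < n ] c * f i)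
*-distribˡ-Σ n c f = *-distribˡ-sum {n} c λ i → f (toℕ i)

*-distribʳ-Σ : ∀ n c (f : ℕ → ℕ) → Σ< n f * c ≡ (Σ[ i < n ] f i * c)
*-distribʳ-Σ n c f = *-distribʳ-sum {n} c λ i → f (toℕ i)

Σ-*-Σ-interchange : ∀ p q (a : ℕ → ℕ) (b : ℕ → ℕ → ℕ) (c : ℕ → ℕ) →
                    (Σ[ k < q ] a k * (Σ[ j < p ] b k j * c j)) ≡ (Σ[ j < p ] (Σ[ k < q ] a k * b k j) * c j)
Σ-*-Σ-interchange p q a b c = begin
  (Σ[ k < q ] a k * (Σ[ j < p ] b k j * c j))
    ≡⟨ Σ-cong q (λ k _ → *-distribˡ-Σ p (a k) (λ j → b k j * c j)) ⟩
  (Σ[ k < q ] Σ[ j < p ] a k * (b k j * c j))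
    ≡⟨ Σ-comm q p (λ k j → a k * (b k j * c j)) ⟩
  (Σ[ j < p ] Σ[ k < q ] a k * (b k j * c j))
    ≡⟨ Σ-cong p (λ j _ → Σ-cong q λ k _ → *-assoc (a k) (b k j) (c j)) ⟨
  (Σ[ j < p ] Σ[ k < q ] a k * b k j * c j)
    ≡⟨ Σ-cong p (λ j _ → *-distribʳ-Σ q (c j) (λ k → a k * b k j)) ⟨
  (Σ[ j < p ] (Σ[ k < q ] a k * b k j) * c j) ∎
  where open ≡-Reasoning

𝟙 : Bool → ℕ
𝟙 true  = 1
𝟙 false = 0

Σ-𝟙-≡ᵇ : ∀ N k (f : ℕ → ℕ) → k < N → (Σ[ r < N ] 𝟙 (r ≡ᵇ k) * f r) ≡ f k
Σ-𝟙-≡ᵇ (suc N) zero    f _         =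
  trans (cong₂ _+_ (+-identityʳ (f 0)) (Σ-zero N λ _ _ → refl)) (+-identityʳ (f 0))
Σ-𝟙-≡ᵇ (suc N) (suc k) f (s≤s k<N) = Σ-𝟙-≡ᵇ N k (λ r → f (suc r)) k<N

sum-applyUpTo : ∀ n (f g : ℕ → ℕ) → sum (map f (applyUpTo g n)) ≡ (Σ[ i < n ] f (g i))
sum-applyUpTo zero    f g = refl
sum-applyUpTo (suc n) f g = cong (f (g 0) +_) (sum-applyUpTo n f (λ i → g (suc i)))

swap : ℕ → ℕ → ℕ → ℕ
swap a b y = if does (y ≟ a) then b else if does (y ≟ b) then a else y

swap-fixes : ∀ {a b y} → y ≢ a → y ≢ b → swap a b y ≡ y
swap-fixes {a} {b} {y} y≢a y≢b rewrite dec-false (y ≟ a) y≢a | dec-false (y ≟ b) y≢b = refl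

swap-maps-right : ∀ a b → swap a b b ≡ a
swap-maps-right a b with b ≟ a
... | yes b≡a rewrite dec-true (b ≟ a) b≡a = b≡a
... | no  b≢a rewrite dec-false (b ≟ a) b≢a | dec-true (b ≟ b) refl = refl

swap-involutive : ∀ a b y → swap a b (swap a b y) ≡ y
swap-involutive a b y with y ≟ a
... | yes refl rewrite dec-true (y ≟ y) refl = swap-maps-right y b
... | no y≢a with y ≟ b
...   | yes refl rewrite dec-false (y ≟ a) y≢a | dec-true (y ≟ y) refl | dec-true (a ≟ a) refl = refl
...   | no y≢b rewrite swap-fixes y≢a y≢b = swap-fixes y≢a y≢b

swap-injective : ∀ a b {y z} → swap a b y ≡ swap a b z → y ≡ z
swap-injective a b {y} {z} eq =
  trans (sym (swap-involutive a b y)) (trans (cong (swap a b) eq) (swap-involutive a b z))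

does-≟-toℕ : ∀ {n} (i j : Fin n) → does (toℕ i ≟ toℕ j) ≡ does (i Fin.≟ j)
does-≟-toℕ i j = does-⇔ (mk⇔ toℕ-injective (cong toℕ)) (toℕ i ≟ toℕ j) (i Fin.≟ j)

toℕ-transpose : ∀ {n} (i j k : Fin n) → toℕ (PC.transpose i j k) ≡ swap (toℕ i) (toℕ j) (toℕ k)
toℕ-transpose i j k rewrite does-≟-toℕ k i | does-≟-toℕ k j with does (k Fin.≟ i)
... | true = refl
... | false with does (k Fin.≟ j)
...   | true = refl
...   | false = refl

Σ-swap : ∀ {x a b} (f : ℕ → ℕ) → a < x → b < x → Σ[ y < x ] f (swap a b y) ≡ Σ< x f
Σ-swap {x} {a} {b} f a<x b<x = begin
  (Σ[ y < x ] f (swap a b y))              ≡⟨ sum-cong-≗ (λ i → cong f (toℕ-transpose′ i)) ⟨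
  ∑ (λ i → f (toℕ (PC.transpose a′ b′ i))) ≡⟨ ∑-permute (λ i → f (toℕ i)) (transpose a′ b′) ⟨
  Σ< x f                                   ∎
  where
  open ≡-Reasoning
  a′ b′ : Fin x
  a′ = fromℕ< a<x
  b′ = fromℕ< b<x

  toℕ-transpose′ : ∀ i → toℕ (PC.transpose a′ b′ i) ≡ swap a b (toℕ i)
  toℕ-transpose′ i = trans (toℕ-transpose a′ b′ i)
                           (cong₂ (λ p q → swap p q (toℕ i)) (toℕ-fromℕ< a<x) (toℕ-fromℕ< b<x))

count : (x n : ℕ) → (Vec ℕ n → Bool) → ℕ
count x zero    Q = 𝟙 (Q [])
count x (suc n) Q = Σ[ y < x ] count x n (λ d → Q (y ∷ d))

count-cong : ∀ x n {Q R : Vec ℕ n → Bool} → (∀ d → Q d ≡ R d) → count x n Q ≡ count x n R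
count-cong x zero    Q≗R = cong 𝟙 (Q≗R [])
count-cong x (suc n) Q≗R = Σ-cong x λ y _ → count-cong x n λ d → Q≗R (y ∷ d)

count-zero : ∀ x n {Q : Vec ℕ n → Bool} → (∀ d → Q d ≡ false) → count x n Q ≡ 0
count-zero x zero    Q≡false = cong 𝟙 (Q≡false [])
count-zero x (suc n) Q≡false = Σ-zero x λ y _ → count-zero x n λ d → Q≡false (y ∷ d)

count-swap : ∀ x n {a b} (Q : Vec ℕ n → Bool) → a < x → b < x →
             count x n (λ d → Q (Vec.map (swap a b) d)) ≡ count x n Q
count-swap x zero    Q a<x b<x = refl
count-swap x (suc n) {a} {b} Q a<x b<x = begin
  Σ[ y < x ] count x n (λ d → Q (swap a b y ∷ Vec.map (swap a b) d))
    ≡⟨ Σ-cong x (λ y _ → count-swap x n (λ d → Q (swap a b y ∷ d)) a<x b<x) ⟩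
  Σ[ y < x ] count x n (λ d → Q (swap a b y ∷ d))
    ≡⟨ Σ-swap (λ y → count x n (λ d → Q (y ∷ d))) a<x b<x ⟩
  Σ[ y < x ] count x n (λ d → Q (y ∷ d)) ∎
  where open ≡-Reasoning

count-++ : ∀ x m n (Q : Vec ℕ (m + n) → Bool) (Q₁ : Vec ℕ m → Bool) (Q₂ : Vec ℕ n → Bool) →
           (∀ xs ys → Q (xs Vec.++ ys) ≡ Q₁ xs ∧ Q₂ ys) →
           count x (m + n) Q ≡ count x m Q₁ * count x n Q₂
count-++ x zero n Q Q₁ Q₂ split = trans (count-cong x n (split [])) (count-∧ˡ (Q₁ []))
  where
  count-∧ˡ : ∀ b → count x n (λ d → b ∧ Q₂ d) ≡ 𝟙 b * count x n Q₂
  count-∧ˡ true  = sym (+-identityʳ _)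
  count-∧ˡ false = count-zero x n λ _ → refl
count-++ x (suc m) n Q Q₁ Q₂ split = begin
  (Σ[ y < x ] count x (m + n) (λ d → Q (y ∷ d)))
    ≡⟨ Σ-cong x (λ y _ → count-++ x m n (λ d → Q (y ∷ d)) (λ d → Q₁ (y ∷ d)) Q₂
                                    λ xs → split (y ∷ xs)) ⟩
  (Σ[ y < x ] count x m (λ d → Q₁ (y ∷ d)) * count x n Q₂)
    ≡⟨ *-distribʳ-Σ x (count x n Q₂) (λ y → count x m (λ d → Q₁ (y ∷ d))) ⟨
  count x (suc m) Q₁ * count x n Q₂ ∎
  where open ≡-Reasoning

SymmetricFrom : ∀ {n} → ℕ → (Vec ℕ n → Bool) → Set
SymmetricFrom u Q = ∀ {a b} → u ≤ a → u ≤ b → ∀ d → Q (Vec.map (swap a b) d) ≡ Q d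

SymmetricFrom-old : ∀ {n u y} (Q : Vec ℕ (suc n) → Bool) → SymmetricFrom u Q → y < u →
                    SymmetricFrom u (λ d → Q (y ∷ d))
SymmetricFrom-old {u = u} {y} Q sym-Q y<u u≤a u≤b d =
  trans (cong (λ z → Q (z ∷ _)) (sym (swap-fixes (y≢ u≤a) (y≢ u≤b)))) (sym-Q u≤a u≤b (_ ∷ d))
  where
  y≢ : ∀ {c} → u ≤ c → y ≢ c
  y≢ u≤c = <⇒≢ (<-≤-trans y<u u≤c)

SymmetricFrom-new : ∀ {n u} (Q : Vec ℕ (suc n) → Bool) → SymmetricFrom u Q →
                    SymmetricFrom (suc u) (λ d → Q (u ∷ d))
SymmetricFrom-new Q sym-Q u<a u<b d =
  trans (cong (λ z → Q (z ∷ _)) (sym (swap-fixes (<⇒≢ u<a) (<⇒≢ u<b))))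
        (sym-Q (<⇒≤ u<a) (<⇒≤ u<b) (_ ∷ d))

count-new-colour : ∀ {n u t z} (Q : Vec ℕ (suc n) → Bool) → SymmetricFrom u Q → z < t →
                   count (u + t) n (λ d → Q (u + z ∷ d)) ≡ count (u + t) n (λ d → Q (u ∷ d))
count-new-colour {n} {u} {t} {z} Q sym-Q z<t = begin
  count (u + t) n (λ d → Q (u + z ∷ d))
    ≡⟨ count-cong (u + t) n recolour ⟩
  count (u + t) n (λ d → Q (u ∷ Vec.map (swap u (u + z)) d))
    ≡⟨ count-swap (u + t) n (λ d → Q (u ∷ d)) (m<m+n u (≤-trans (s≤s z≤n) z<t)) (+-monoʳ-< u z<t) ⟩
  count (u + t) n (λ d → Q (u ∷ d)) ∎
  where
  open ≡-Reasoning
  recolour : ∀ d → Q (u + z ∷ d) ≡ Q (u ∷ Vec.map (swap u (u + z)) d)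
  recolour d = begin
    Q (u + z ∷ d)                      ≡⟨ sym-Q ≤-refl (m≤m+n u z) (u + z ∷ d) ⟨
    Q (σ (u + z) ∷ Vec.map σ d)        ≡⟨ cong (λ c → Q (c ∷ Vec.map σ d)) (swap-maps-right u (u + z)) ⟩
    Q (u ∷ Vec.map σ d)                ∎
    where σ = swap u (u + z)

-- Restricted growth strings and falling factorials

infixl 8 _↓_
_↓_ : ℕ → ℕ → ℕ
x ↓ zero  = 1
x ↓ suc r = x * (x ∸ 1) ↓ r

-- countRG n u r Q counts the d ∈ ℕⁿ with Q d that are restricted growth strings
-- continuing a prefix which used the colours 0, …, u - 1: each entry is an old
-- colour or the least unused one, and exactly r new colours appear.
mutual
  countRG : (n u r : ℕ) → (Vec ℕ n → Bool) → ℕ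
  countRG zero    u zero    Q = 𝟙 (Q [])
  countRG zero    u (suc r) Q = 0
  countRG (suc n) u r       Q = (Σ[ y < u ] countRG n u r (λ d → Q (y ∷ d))) + countRG-new n u r Q

  countRG-new : (n u r : ℕ) → (Vec ℕ (suc n) → Bool) → ℕ
  countRG-new n u zero    Q = 0
  countRG-new n u (suc r) Q = countRG n (suc u) r (λ d → Q (u ∷ d))

-- The first entry is an old colour y < u or one of the t colours u + z.  This is the recursion t ↓ (1 + r) = t · (t - 1) ↓ r.
count-expansion : ∀ n u t N (Q : Vec ℕ n → Bool) → SymmetricFrom u Q → n < N →
                  count (u + t) n Q ≡ Σ[ r < N ] countRG n u r Q * t ↓ r
count-expansion zero u t (suc N) Q _ _ =
  sym (trans (cong₂ _+_ (*-identityʳ (𝟙 (Q []))) (Σ-zero N λ _ _ → refl)) (+-identityʳ (𝟙 (Q []))))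
count-expansion (suc n) u t (suc N) Q sym-Q (s≤s n<N) = begin
  count (u + t) (suc n) Q
    ≡⟨ Σ-split u t (λ y → count (u + t) n (λ d → Q (y ∷ d))) ⟩
  (Σ[ y < u ] count (u + t) n (λ d → Q (y ∷ d))) + (Σ[ z < t ] count (u + t) n (λ d → Q (u + z ∷ d)))
    ≡⟨ cong₂ _+_ old-colours (new-colours t refl) ⟩
  (Σ[ r < suc N ] old r * t ↓ r) + (Σ[ r < suc N ] countRG-new n u r Q * t ↓ r)
    ≡⟨ Σ-distrib-+ (suc N) (λ r → old r * t ↓ r) (λ r → countRG-new n u r Q * t ↓ r) ⟨
  Σ[ r < suc N ] (old r * t ↓ r + countRG-new n u r Q * t ↓ r)
    ≡⟨ Σ-cong (suc N) (λ r _ → *-distribʳ-+ (t ↓ r) (old r) (countRG-new n u r Q)) ⟨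
  Σ[ r < suc N ] countRG (suc n) u r Q * t ↓ r ∎
  where
  open ≡-Reasoning
  old : ℕ → ℕ
  old r = Σ[ y < u ] countRG n u r (λ d → Q (y ∷ d))

  old-colours : Σ[ y < u ] count (u + t) n (λ d → Q (y ∷ d)) ≡ Σ[ r < suc N ] old r * t ↓ r
  old-colours = begin
    Σ[ y < u ] count (u + t) n (λ d → Q (y ∷ d))
      ≡⟨ Σ-cong u (λ y y<u → count-expansion n u t (suc N) _ (SymmetricFrom-old Q sym-Q y<u)
                                                              (m<n⇒m<1+n n<N)) ⟩
    Σ[ y < u ] Σ[ r < suc N ] countRG n u r (λ d → Q (y ∷ d)) * t ↓ r
      ≡⟨ Σ-comm u (suc N) (λ y r → countRG n u r (λ d → Q (y ∷ d)) * t ↓ r) ⟩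
    Σ[ r < suc N ] Σ[ y < u ] countRG n u r (λ d → Q (y ∷ d)) * t ↓ r
      ≡⟨ Σ-cong (suc N) (λ r _ → *-distribʳ-Σ u (t ↓ r) (λ y → countRG n u r (λ d → Q (y ∷ d)))) ⟨
    Σ[ r < suc N ] old r * t ↓ r ∎

  new-colours : ∀ s → s ≡ t → Σ[ z < s ] count (u + t) n (λ d → Q (u + z ∷ d))
                             ≡ Σ[ r < suc N ] countRG-new n u r Q * s ↓ r
  new-colours zero    _    = sym (Σ-zero N {λ r → new r * 0} λ r _ → *-zeroʳ (new r))
    where
    new : ℕ → ℕ
    new r = countRG n (suc u) r (λ d → Q (u ∷ d))
  new-colours (suc s) refl = begin
    Σ[ z < suc s ] count (u + suc s) n (λ d → Q (u + z ∷ d))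
      ≡⟨ Σ-cong (suc s) (λ z z<t → count-new-colour Q sym-Q z<t) ⟩
    Σ[ _ < suc s ] count (u + suc s) n (λ d → Q (u ∷ d))
      ≡⟨ Σ-const (suc s) _ ⟩
    suc s * count (u + suc s) n (λ d → Q (u ∷ d))
      ≡⟨ cong (λ x → suc s * count x n (λ d → Q (u ∷ d))) (+-suc u s) ⟩
    suc s * count (suc u + s) n (λ d → Q (u ∷ d))
      ≡⟨ cong (suc s *_) (count-expansion n (suc u) s N _ (SymmetricFrom-new Q sym-Q) n<N) ⟩
    suc s * (Σ[ r < N ] countRG n (suc u) r (λ d → Q (u ∷ d)) * s ↓ r)
      ≡⟨ *-distribˡ-Σ N (suc s) (λ r → countRG n (suc u) r (λ d → Q (u ∷ d)) * s ↓ r) ⟩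
    Σ[ r < N ] suc s * (countRG n (suc u) r (λ d → Q (u ∷ d)) * s ↓ r)
      ≡⟨ Σ-cong N (λ r _ → x*[y*z]≡y*[x*z] (suc s) (countRG n (suc u) r (λ d → Q (u ∷ d))) (s ↓ r)) ⟩
    Σ[ r < suc N ] countRG-new n u r Q * suc s ↓ r ∎

canonicalℕ : ∀ {n} → ℕ → ℕ → Vec ℕ n → Bool
canonicalℕ k u []      = u ≡ᵇ k
canonicalℕ k u (x ∷ v) = (x ≤ᵇ u) ∧ canonicalℕ k (u ⊔ suc x) v

canonical-toℕ : ∀ {n k} u (c : Vec (Fin k) n) → canonical u c ≡ canonicalℕ k u (Vec.map toℕ c)
canonical-toℕ u []      = refl
canonical-toℕ u (x ∷ c) = cong ((toℕ x ≤ᵇ u) ∧_) (canonical-toℕ (u ⊔ suc (toℕ x)) c)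

count-canonical : ∀ n u r (Q : Vec ℕ n → Bool) →
                  count (u + r) n (λ v → Q v ∧ canonicalℕ (u + r) u v) ≡ countRG n u r Q
count-canonical zero u zero Q
  rewrite +-identityʳ u | dec-true (u ≟ u) refl = cong 𝟙 (∧-identityʳ (Q []))
count-canonical zero u (suc r) Q
  rewrite dec-false (u ≟ u + suc r) (<⇒≢ (m<m+n u (s≤s z≤n))) = cong 𝟙 (∧-zeroʳ (Q []))
count-canonical (suc n) u r Q = begin
  (Σ[ y < u + r ] count (u + r) n (P y))
    ≡⟨ Σ-split u r (λ y → count (u + r) n (P y)) ⟩
  (Σ[ y < u ] count (u + r) n (P y)) + (Σ[ z < r ] count (u + r) n (P (u + z)))
    ≡⟨ cong₂ _+_ (Σ-cong u λ y y<u → trans (count-cong (u + r) n (old-colour y<u))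
                                           (count-canonical n u r (λ d → Q (y ∷ d))))
                 (new-colour r refl) ⟩
  countRG (suc n) u r Q ∎
  where
  open ≡-Reasoning
  P : ℕ → Vec ℕ n → Bool
  P y d = Q (y ∷ d) ∧ ((y ≤ᵇ u) ∧ canonicalℕ (u + r) (u ⊔ suc y) d)

  old-colour : ∀ {y} → y < u → ∀ d → P y d ≡ Q (y ∷ d) ∧ canonicalℕ (u + r) u d
  old-colour {y} y<u d rewrite dec-true (y ≤? u) (<⇒≤ y<u) | m≥n⇒m⊔n≡m y<u = refl

  later-new-colour : ∀ z d → P (u + suc z) d ≡ false
  later-new-colour z d rewrite dec-false (u + suc z ≤? u) (<⇒≱ (m<m+n u (s≤s z≤n))) = ∧-zeroʳ _

  new-colour : ∀ s → s ≡ r → (Σ[ z < s ] count (u + r) n (P (u + z))) ≡ countRG-new n u s Q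
  new-colour zero    _    = refl
  new-colour (suc s) refl = begin
    count (u + suc s) n (P (u + 0)) + (Σ[ z < s ] count (u + suc s) n (P (u + suc z)))
      ≡⟨ cong₂ _+_ first-new-colour (Σ-zero s λ z _ → count-zero (u + suc s) n (later-new-colour z)) ⟩
    countRG n (suc u) s (λ d → Q (u ∷ d)) + 0
      ≡⟨ +-identityʳ _ ⟩
    countRG n (suc u) s (λ d → Q (u ∷ d)) ∎
    where
    first-new-colour : count (u + suc s) n (P (u + 0)) ≡ countRG n (suc u) s (λ d → Q (u ∷ d))
    first-new-colour rewrite +-identityʳ u | dec-true (u ≤? u) ≤-refl | m≤n⇒m⊔n≡n (n≤1+n u) | +-suc u s =
      count-canonical n (suc u) s (λ d → Q (u ∷ d))

countRG-cong : ∀ n u r {Q R : Vec ℕ n → Bool} → (∀ d → Q d ≡ R d) → countRG n u r Q ≡ countRG n u r R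
countRG-cong n u r {Q} {R} Q≗R = begin
  countRG n u r Q
    ≡⟨ count-canonical n u r Q ⟨
  count (u + r) n (λ v → Q v ∧ canonicalℕ (u + r) u v)
    ≡⟨ count-cong (u + r) n (λ v → cong (_∧ _) (Q≗R v)) ⟩
  count (u + r) n (λ v → R v ∧ canonicalℕ (u + r) u v)
    ≡⟨ count-canonical n u r R ⟩
  countRG n u r R ∎
  where open ≡-Reasoning

countRG-zero : ∀ n u r {Q : Vec ℕ n → Bool} → (∀ d → Q d ≡ false) → countRG n u r Q ≡ 0
countRG-zero n u r {Q} Q≡false =
  trans (sym (count-canonical n u r Q)) (count-zero (u + r) n λ v → cong (_∧ _) (Q≡false v))

countRG-vanish : ∀ n u r (Q : Vec ℕ n → Bool) → n < r → countRG n u r Q ≡ 0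
countRG-vanish zero    u (suc r) Q _         = refl
countRG-vanish (suc n) u (suc r) Q (s≤s n<r) =
  cong₂ _+_ (Σ-zero u λ y _ → countRG-vanish n u (suc r) (λ d → Q (y ∷ d)) (m<n⇒m<1+n n<r))
            (countRG-vanish n (suc u) r (λ d → Q (u ∷ d)) n<r)

Σ-↓-at-zero : ∀ M (c : ℕ → ℕ) → (Σ[ j < suc M ] c j * 0 ↓ j) ≡ c 0
Σ-↓-at-zero M c = begin
  c 0 * 1 + (Σ[ j < M ] c (suc j) * 0) ≡⟨ cong (c 0 * 1 +_) (Σ-zero M λ j _ → *-zeroʳ (c (suc j))) ⟩
  c 0 * 1 + 0                          ≡⟨ +-identityʳ _ ⟩
  c 0 * 1                              ≡⟨ *-identityʳ _ ⟩
  c 0                                  ∎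
  where open ≡-Reasoning

Σ-↓-at-suc : ∀ M x (c : ℕ → ℕ) →
             (Σ[ j < suc M ] c j * suc x ↓ j) ≡ c 0 * 1 + suc x * (Σ[ j < M ] c (suc j) * x ↓ j)
Σ-↓-at-suc M x c = cong (c 0 * 1 +_) (begin
  (Σ[ j < M ] c (suc j) * (suc x * x ↓ j))
    ≡⟨ Σ-cong M (λ j _ → x*[y*z]≡y*[x*z] (c (suc j)) (suc x) (x ↓ j)) ⟩
  (Σ[ j < M ] suc x * (c (suc j) * x ↓ j))
    ≡⟨ *-distribˡ-Σ M (suc x) (λ j → c (suc j) * x ↓ j) ⟨
  suc x * (Σ[ j < M ] c (suc j) * x ↓ j) ∎)
  where open ≡-Reasoning

↓-coefficients-unique : ∀ M (a b : ℕ → ℕ) →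
                        (∀ x → (Σ[ j < M ] a j * x ↓ j) ≡ (Σ[ j < M ] b j * x ↓ j)) →
                        ∀ j → j < M → a j ≡ b j
↓-coefficients-unique (suc M) a b same = coefficient
  where
  a₀≡b₀ : a 0 ≡ b 0
  a₀≡b₀ = trans (sym (Σ-↓-at-zero M a)) (trans (same 0) (Σ-↓-at-zero M b))

  same-shifted : ∀ x → (Σ[ j < M ] a (suc j) * x ↓ j) ≡ (Σ[ j < M ] b (suc j) * x ↓ j)
  same-shifted x = *-cancelˡ-≡ _ _ (suc x) (+-cancelˡ-≡ (a 0 * 1) _ _ (begin
    a 0 * 1 + suc x * _ ≡⟨ Σ-↓-at-suc M x a ⟨
    (Σ[ j < suc M ] a j * suc x ↓ j) ≡⟨ same (suc x) ⟩
    (Σ[ j < suc M ] b j * suc x ↓ j) ≡⟨ Σ-↓-at-suc M x b ⟩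
    b 0 * 1 + suc x * _ ≡⟨ cong (λ c → c * 1 + _) a₀≡b₀ ⟨
    a 0 * 1 + suc x * _ ∎))
    where open ≡-Reasoning

  coefficient : ∀ j → j < suc M → a j ≡ b j
  coefficient zero    _         = a₀≡b₀
  coefficient (suc j) (s≤s j<M) =
    ↓-coefficients-unique M (λ i → a (suc i)) (λ i → b (suc i)) same-shifted j j<M

-- Proper colourings

⋀-++ : ∀ m n (p : Fin (m + n) → Bool) → ⋀ p ≡ ⋀ (λ i → p (i ↑ˡ n)) ∧ ⋀ (λ j → p (m ↑ʳ j))
⋀-++ zero    n p = refl
⋀-++ (suc m) n p = trans (cong (p zero ∧_) (⋀-++ m n (λ i → p (suc i)))) (sym (∧-assoc (p zero) _ _))

all-allFin : ∀ n (p : Fin n → Bool) → all p (allFin n) ≡ ⋀ p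
all-allFin n p = trans (cong and (map-tabulate (λ i → i) p)) (and-tabulate n p)
  where
  and-tabulate : ∀ n (p : Fin n → Bool) → and (tabulate p) ≡ ⋀ p
  and-tabulate zero    p = refl
  and-tabulate (suc n) p = cong (p zero ∧_) (and-tabulate n (λ i → p (suc i)))

⌊⌋-⇔ : ∀ {A B : Set} → A ⇔ B → (a? : Dec A) (b? : Dec B) → ⌊ a? ⌋ ≡ ⌊ b? ⌋
⌊⌋-⇔ A⇔B a? b? = trans (isYes≗does a?) (trans (does-⇔ A⇔B a? b?) (sym (isYes≗does b?)))

isProper : ∀ {A : Set} {n} → DecidableEquality A → Graph n → Vec A n → Bool
isProper _≟ᴬ_ G v = ⋀ λ i → ⋀ λ j → not (G i j) ∨ not ⌊ lookup v i ≟ᴬ lookup v j ⌋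

properℕ : ∀ {n} → Graph n → Vec ℕ n → Bool
properℕ = isProper _≟_

isProper-map : ∀ {A B : Set} (_≟ᴬ_ : DecidableEquality A) (_≟ᴮ_ : DecidableEquality B) {n} (G : Graph n)
               (σ : A → B) → (∀ {a b} → σ a ≡ σ b → a ≡ b) →
               ∀ v → isProper _≟ᴮ_ G (Vec.map σ v) ≡ isProper _≟ᴬ_ G v
isProper-map _≟ᴬ_ _≟ᴮ_ G σ σ-injective v = ⋀-cong λ i → ⋀-cong λ j → cong (λ b → not (G i j) ∨ not b)
  (trans (cong₂ (λ a b → ⌊ a ≟ᴮ b ⌋) (lookup-map i σ v) (lookup-map j σ v))
         (σ-clash (lookup v i) (lookup v j)))
  where
  σ-clash : ∀ a b → ⌊ σ a ≟ᴮ σ b ⌋ ≡ ⌊ a ≟ᴬ b ⌋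
  σ-clash a b = ⌊⌋-⇔ (mk⇔ σ-injective (cong σ)) (σ a ≟ᴮ σ b) (a ≟ᴬ b)

properℕ-symmetric : ∀ {n} (G : Graph n) u → SymmetricFrom u (properℕ G)
properℕ-symmetric G u {a} {b} _ _ = isProper-map _≟_ _≟_ G (swap a b) (swap-injective a b)

proper-toℕ : ∀ {n k} (G : Graph n) (c : Vec (Fin k) n) → proper G c ≡ properℕ G (Vec.map toℕ c)
proper-toℕ {n} G c = begin
  proper G c                    ≡⟨ all-allFin n (λ i → all (edge i) (allFin n)) ⟩
  ⋀ (λ i → all (edge i) (allFin n)) ≡⟨ ⋀-cong (λ i → all-allFin n (edge i)) ⟩
  isProper Fin._≟_ G c          ≡⟨ isProper-map Fin._≟_ _≟_ G toℕ toℕ-injective c ⟨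
  properℕ G (Vec.map toℕ c)         ∎
  where
  open ≡-Reasoning
  edge : Fin n → Fin n → Bool
  edge i j = not (G i j) ∨ not ⌊ lookup c i Fin.≟ lookup c j ⌋

length-filter-map : ∀ {A B : Set} (P : B → Bool) (g : A → B) (xs : List A) →
                    length (filter (λ b → T? (P b)) (map g xs)) ≡ length (filter (λ a → T? (P (g a))) xs)
length-filter-map P g []       = refl
length-filter-map P g (x ∷ xs) with P (g x)
... | true  = cong suc (length-filter-map P g xs)
... | false = length-filter-map P g xs

length-filter-concatMap : ∀ {A B : Set} (P : B → Bool) (f : A → List B) (xs : List A) →
                          length (filter (λ b → T? (P b)) (concatMap f xs))
                          ≡ sum (map (λ a → length (filter (λ b → T? (P b)) (f a))) xs)
length-filter-concatMap P f []       = refl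
length-filter-concatMap P f (x ∷ xs) = begin
  length (filter P? (f x ++ concatMap f xs))
    ≡⟨ cong length (filter-++ P? (f x) (concatMap f xs)) ⟩
  length (filter P? (f x) ++ filter P? (concatMap f xs))
    ≡⟨ length-++ (filter P? (f x)) ⟩
  length (filter P? (f x)) + length (filter P? (concatMap f xs))
    ≡⟨ cong (length (filter P? (f x)) +_) (length-filter-concatMap P f xs) ⟩
  length (filter P? (f x)) + sum (map (λ a → length (filter P? (f a))) xs) ∎
  where
  open ≡-Reasoning
  P? = λ b → T? (P b)

sum-map-allFin : ∀ k (f : Fin k → ℕ) → sum (map f (allFin k)) ≡ ∑ f
sum-map-allFin k f = trans (cong sum (map-tabulate (λ i → i) f)) (sum-tabulate k f)
  where
  sum-tabulate : ∀ k (f : Fin k → ℕ) → sum (tabulate f) ≡ ∑ f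
  sum-tabulate zero    f = refl
  sum-tabulate (suc k) f = cong (f zero +_) (sum-tabulate k (λ i → f (suc i)))

count-allColourings : ∀ k n (P : Vec (Fin k) n → Bool) (Q : Vec ℕ n → Bool) →
                      (∀ c → P c ≡ Q (Vec.map toℕ c)) →
                      length (filter (λ c → T? (P c)) (allColourings k n)) ≡ count k n Q
count-allColourings k zero P Q P≡Q with P [] | P≡Q []
... | true  | Q[]≡true  rewrite sym Q[]≡true  = refl
... | false | Q[]≡false rewrite sym Q[]≡false = refl
count-allColourings k (suc n) P Q P≡Q = begin
  length (filter (λ c → T? (P c)) (concatMap (λ y → map (y ∷_) (allColourings k n)) (allFin k)))
    ≡⟨ length-filter-concatMap P (λ y → map (y ∷_) (allColourings k n)) (allFin k) ⟩
  sum (map (λ y → length (filter (λ c → T? (P c)) (map (y ∷_) (allColourings k n)))) (allFin k))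
    ≡⟨ cong sum (map-cong (λ y → trans (length-filter-map P (y ∷_) (allColourings k n))
                                       (count-allColourings k n _ _ (λ c → P≡Q (y ∷ c)))) (allFin k)) ⟩
  sum (map (λ y → count k n (λ d → Q (toℕ y ∷ d))) (allFin k))
    ≡⟨ sum-map-allFin k (λ y → count k n (λ d → Q (toℕ y ∷ d))) ⟩
  count k (suc n) Q ∎
  where open ≡-Reasoning

module _ {m n : ℕ} (G : Graph m) (H : Graph n) where

  ∪-↑ˡ-↑ˡ : ∀ i j → (G ∪ H) (i ↑ˡ n) (j ↑ˡ n) ≡ G i j
  ∪-↑ˡ-↑ˡ i j rewrite splitAt-↑ˡ m i n | splitAt-↑ˡ m j n = refl

  ∪-↑ˡ-↑ʳ : ∀ i j → (G ∪ H) (i ↑ˡ n) (m ↑ʳ j) ≡ false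
  ∪-↑ˡ-↑ʳ i j rewrite splitAt-↑ˡ m i n | splitAt-↑ʳ m n j = refl

  ∪-↑ʳ-↑ˡ : ∀ i j → (G ∪ H) (m ↑ʳ i) (j ↑ˡ n) ≡ false
  ∪-↑ʳ-↑ˡ i j rewrite splitAt-↑ʳ m n i | splitAt-↑ˡ m j n = refl

  ∪-↑ʳ-↑ʳ : ∀ i j → (G ∪ H) (m ↑ʳ i) (m ↑ʳ j) ≡ H i j
  ∪-↑ʳ-↑ʳ i j rewrite splitAt-↑ʳ m n i | splitAt-↑ʳ m n j = refl

  properℕ-∪ : ∀ xs ys → properℕ (G ∪ H) (xs Vec.++ ys) ≡ properℕ G xs ∧ properℕ H ys
  properℕ-∪ xs ys = begin
    ⋀ (λ I → ⋀ λ J → ok I J)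
      ≡⟨ ⋀-++ m n (λ I → ⋀ λ J → ok I J) ⟩
    ⋀ (λ i → ⋀ λ J → ok (i ↑ˡ n) J) ∧ ⋀ (λ i → ⋀ λ J → ok (m ↑ʳ i) J)
      ≡⟨ cong₂ _∧_ (⋀-cong λ i → ⋀-++ m n (ok (i ↑ˡ n))) (⋀-cong λ i → ⋀-++ m n (ok (m ↑ʳ i))) ⟩
    ⋀ (λ i → ⋀ (λ j → ok (i ↑ˡ n) (j ↑ˡ n)) ∧ ⋀ (λ j → ok (i ↑ˡ n) (m ↑ʳ j)))
      ∧ ⋀ (λ i → ⋀ (λ j → ok (m ↑ʳ i) (j ↑ˡ n)) ∧ ⋀ (λ j → ok (m ↑ʳ i) (m ↑ʳ j)))
      ≡⟨ cong₂ _∧_ (⋀-cong λ i → cong₂ _∧_ (⋀-cong (left i)) (no-edges (∪-↑ˡ-↑ʳ i)))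
                   (⋀-cong λ i → cong₂ _∧_ (no-edges (∪-↑ʳ-↑ˡ i)) (⋀-cong (right i))) ⟩
    ⋀ (λ i → ⋀ (λ j → okᴳ i j) ∧ true) ∧ ⋀ (λ i → true ∧ ⋀ (λ j → okᴴ i j))
      ≡⟨ cong (_∧ properℕ H ys) (⋀-cong {m} λ i → ∧-identityʳ (⋀ λ j → okᴳ i j)) ⟩
    properℕ G xs ∧ properℕ H ys ∎
    where
    open ≡-Reasoning
    ok : Fin (m + n) → Fin (m + n) → Bool
    ok I J = not ((G ∪ H) I J) ∨ not ⌊ lookup (xs Vec.++ ys) I ≟ lookup (xs Vec.++ ys) J ⌋

    okᴳ : Fin m → Fin m → Bool
    okᴳ i j = not (G i j) ∨ not ⌊ lookup xs i ≟ lookup xs j ⌋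

    okᴴ : Fin n → Fin n → Bool
    okᴴ i j = not (H i j) ∨ not ⌊ lookup ys i ≟ lookup ys j ⌋

    no-edges : ∀ {k} {I : Fin k → Fin (m + n)} {J} → (∀ j → (G ∪ H) J (I j) ≡ false) →
               ⋀ (λ j → ok J (I j)) ≡ true
    no-edges {k} none = trans (⋀-cong λ j → cong (λ e → not e ∨ _) (none j)) (⋀-true k)

    left : ∀ i j → ok (i ↑ˡ n) (j ↑ˡ n) ≡ okᴳ i j
    left i j = cong₂ (λ e c → not e ∨ not c) (∪-↑ˡ-↑ˡ i j)
                 (cong₂ (λ a b → ⌊ a ≟ b ⌋) (lookup-++ˡ xs ys i) (lookup-++ˡ xs ys j))

    right : ∀ i j → ok (m ↑ʳ i) (m ↑ʳ j) ≡ okᴴ i j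
    right i j = cong₂ (λ e c → not e ∨ not c) (∪-↑ʳ-↑ʳ i j)
                  (cong₂ (λ a b → ⌊ a ≟ b ⌋) (lookup-++ʳ xs ys i) (lookup-++ʳ xs ys j))

fresh : ∀ {k} → ℕ → Vec ℕ k → Bool
fresh y d = ⋀ λ j → not ⌊ y ≟ lookup d j ⌋

above : ∀ {k} → ℕ → Vec ℕ k → Bool
above u d = ⋀ λ j → ⌊ u ≤? lookup d j ⌋

properℕ-K-∷ : ∀ k y (d : Vec ℕ k) → properℕ (K (suc k)) (y ∷ d) ≡ fresh y d ∧ properℕ (K k) d
properℕ-K-∷ k y d = begin
  fresh y d ∧ ⋀ (λ i → not ⌊ lookup d i ≟ y ⌋ ∧ row i)
    ≡⟨ cong (fresh y d ∧_) (⋀-distrib-∧ (λ i → not ⌊ lookup d i ≟ y ⌋) row) ⟩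
  fresh y d ∧ (⋀ (λ i → not ⌊ lookup d i ≟ y ⌋) ∧ ⋀ row)
    ≡⟨ cong₂ (λ a b → fresh y d ∧ (a ∧ b))
             (⋀-cong λ i → cong not (⌊⌋-⇔ (mk⇔ sym sym) (lookup d i ≟ y) (y ≟ lookup d i)))
             (⋀-cong λ i → ⋀-cong λ j → cong (λ e → not e ∨ clash i j) (K-suc i j)) ⟩
  fresh y d ∧ (fresh y d ∧ properℕ (K k) d)
    ≡⟨ ∧-assoc (fresh y d) _ _ ⟨
  (fresh y d ∧ fresh y d) ∧ properℕ (K k) d
    ≡⟨ cong (_∧ properℕ (K k) d) (∧-idem (fresh y d)) ⟩
  fresh y d ∧ properℕ (K k) d ∎
  where
  open ≡-Reasoning
  clash : Fin k → Fin k → Bool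
  clash i j = not ⌊ lookup d i ≟ lookup d j ⌋

  row : Fin k → Bool
  row i = ⋀ λ j → not (K (suc k) (suc i) (suc j)) ∨ clash i j

  K-suc : ∀ i j → K (suc k) (suc i) (suc j) ≡ K k i j
  K-suc i j = cong not (⌊⌋-map′ (cong suc) Fin.suc-injective (i Fin.≟ j))

fresh∧above : ∀ {k} u (d : Vec ℕ k) → fresh u d ∧ above u d ≡ above (suc u) d
fresh∧above {k} u d = trans (sym (⋀-distrib-∧ {k} _ _)) (⋀-cong λ j → fresh-above (lookup d j))
  where
  fresh-above : ∀ z → not ⌊ u ≟ z ⌋ ∧ ⌊ u ≤? z ⌋ ≡ ⌊ suc u ≤? z ⌋
  fresh-above z = begin
    not ⌊ u ≟ z ⌋ ∧ ⌊ u ≤? z ⌋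
      ≡⟨ cong₂ (λ a b → not a ∧ b) (isYes≗does (u ≟ z)) (isYes≗does (u ≤? z)) ⟩
    does (¬? (u ≟ z) ×-dec (u ≤? z))
      ≡⟨ does-⇔ u≢z×u≤z⇔u<z (¬? (u ≟ z) ×-dec (u ≤? z)) (suc u ≤? z) ⟩
    does (suc u ≤? z)
      ≡⟨ isYes≗does (suc u ≤? z) ⟨
    ⌊ suc u ≤? z ⌋ ∎
    where
    open ≡-Reasoning
    u≢z×u≤z⇔u<z = mk⇔ (λ (u≢z , u≤z) → ≤∧≢⇒< u≤z u≢z) (λ u<z → <⇒≢ u<z , <⇒≤ u<z)

countRG-K : ∀ k u r → countRG k u r (λ d → properℕ (K k) d ∧ above u d) ≡ 𝟙 (r ≡ᵇ k)
countRG-K zero    u zero    = refl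
countRG-K zero    u (suc r) = refl
countRG-K (suc k) u r       = cong₂ _+_ (Σ-zero u λ y y<u → countRG-zero k u r (old-colour y<u)) (new-colour r)
  where
  Q : Vec ℕ (suc k) → Bool
  Q d = properℕ (K (suc k)) d ∧ above u d

  old-colour : ∀ {y} → y < u → ∀ d → Q (y ∷ d) ≡ false
  old-colour {y} y<u d =
    trans (cong (λ b → properℕ (K (suc k)) (y ∷ d) ∧ (b ∧ above u d)) u≰y) (∧-zeroʳ _)
    where
    u≰y : ⌊ u ≤? y ⌋ ≡ false
    u≰y = trans (isYes≗does (u ≤? y)) (dec-false (u ≤? y) (<⇒≱ y<u))

  new-colour : ∀ r → countRG-new k u r Q ≡ 𝟙 (r ≡ᵇ suc k)
  new-colour zero    = refl
  new-colour (suc r) = trans (countRG-cong k (suc u) r first-new) (countRG-K k (suc u) r)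
    where
    first-new : ∀ d → Q (u ∷ d) ≡ properℕ (K k) d ∧ above (suc u) d
    first-new d = begin
      properℕ (K (suc k)) (u ∷ d) ∧ (⌊ u ≤? u ⌋ ∧ above u d)
        ≡⟨ cong₂ (λ p b → p ∧ (b ∧ above u d)) (properℕ-K-∷ k u d) u≤u ⟩
      (fresh u d ∧ properℕ (K k) d) ∧ above u d
        ≡⟨ [x∧y]∧z≡y∧[x∧z] (fresh u d) (properℕ (K k) d) (above u d) ⟩
      properℕ (K k) d ∧ (fresh u d ∧ above u d)
        ≡⟨ cong (properℕ (K k) d ∧_) (fresh∧above u d) ⟩
      properℕ (K k) d ∧ above (suc u) d ∎
      where
      open ≡-Reasoning
      u≤u : ⌊ u ≤? u ⌋ ≡ true
      u≤u = trans (isYes≗does (u ≤? u)) (dec-true (u ≤? u) ≤-refl)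

-- The chromatic polynomial

chromatic : ∀ {n} → Graph n → ℕ → ℕ
chromatic {n} G x = count x n (properℕ G)

S≡countRG : ∀ {n} (G : Graph n) k → S G k ≡ countRG n 0 k (properℕ G)
S≡countRG {n} G k = trans
  (count-allColourings k n _ (λ v → properℕ G v ∧ canonicalℕ k 0 v)
                       λ c → cong₂ _∧_ (proper-toℕ G c) (canonical-toℕ 0 c))
  (count-canonical n 0 k (properℕ G))

S-vanish : ∀ {n} (G : Graph n) r → n < r → S G r ≡ 0
S-vanish {n} G r n<r = trans (S≡countRG G r) (countRG-vanish n 0 r (properℕ G) n<r)

chromatic-expansion : ∀ {n} (G : Graph n) x N → n < N → chromatic G x ≡ (Σ[ r < N ] S G r * x ↓ r)
chromatic-expansion {n} G x N n<N = trans
  (count-expansion n 0 x N (properℕ G) (properℕ-symmetric G 0) n<N)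
  (Σ-cong N λ r _ → cong (_* x ↓ r) (sym (S≡countRG G r)))

chromatic-∪ : ∀ {m n} (G : Graph m) (H : Graph n) x → chromatic (G ∪ H) x ≡ chromatic G x * chromatic H x
chromatic-∪ {m} {n} G H x = count-++ x m n (properℕ (G ∪ H)) (properℕ G) (properℕ H) (properℕ-∪ G H)

chromatic-K : ∀ k x → chromatic (K k) x ≡ x ↓ k
chromatic-K k x = begin
  chromatic (K k) x
    ≡⟨ count-expansion k 0 x (suc k) (properℕ (K k)) (properℕ-symmetric (K k) 0) ≤-refl ⟩
  (Σ[ r < suc k ] countRG k 0 r (properℕ (K k)) * x ↓ r)
    ≡⟨ Σ-cong (suc k) (λ r _ → cong (_* x ↓ r) (countRG-δ r)) ⟩
  (Σ[ r < suc k ] 𝟙 (r ≡ᵇ k) * x ↓ r)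
    ≡⟨ Σ-𝟙-≡ᵇ (suc k) k (x ↓_) ≤-refl ⟩
  x ↓ k ∎
  where
  open ≡-Reasoning
  all-above-0 : ∀ d → properℕ (K k) d ≡ properℕ (K k) d ∧ above 0 d
  all-above-0 d = sym (trans (cong (properℕ (K k) d ∧_) (⋀-true k)) (∧-identityʳ _))

  countRG-δ : ∀ r → countRG k 0 r (properℕ (K k)) ≡ 𝟙 (r ≡ᵇ k)
  countRG-δ r = trans (countRG-cong k 0 r all-above-0) (countRG-K k 0 r)

S-∪-coefficient : ∀ {m n} (G : Graph m) (H : Graph n) j → j < suc (m + n) →
                  S (G ∪ H) j ≡ (Σ[ k < suc n ] S H k * S (G ∪ K k) j)
S-∪-coefficient {m} {n} G H =
  ↓-coefficients-unique (suc (m + n)) (S (G ∪ H)) (λ j → Σ[ k < suc n ] S H k * S (G ∪ K k) j) same-polynomial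
  where
  same-polynomial : ∀ x → (Σ[ j < suc (m + n) ] S (G ∪ H) j * x ↓ j)
                        ≡ (Σ[ j < suc (m + n) ] (Σ[ k < suc n ] S H k * S (G ∪ K k) j) * x ↓ j)
  same-polynomial x = begin
    (Σ[ j < suc (m + n) ] S (G ∪ H) j * x ↓ j)
      ≡⟨ chromatic-expansion (G ∪ H) x (suc (m + n)) ≤-refl ⟨
    chromatic (G ∪ H) x
      ≡⟨ chromatic-∪ G H x ⟩
    chromatic G x * chromatic H x
      ≡⟨ cong (chromatic G x *_) (chromatic-expansion H x (suc n) ≤-refl) ⟩
    chromatic G x * (Σ[ k < suc n ] S H k * x ↓ k)
      ≡⟨ *-distribˡ-Σ (suc n) (chromatic G x) (λ k → S H k * x ↓ k) ⟩
    (Σ[ k < suc n ] chromatic G x * (S H k * x ↓ k))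
      ≡⟨ Σ-cong (suc n) (λ k _ → x*[y*z]≡y*[x*z] (chromatic G x) (S H k) (x ↓ k)) ⟩
    (Σ[ k < suc n ] S H k * (chromatic G x * x ↓ k))
      ≡⟨ Σ-cong (suc n) (λ k k≤n → cong (S H k *_) (adjoin-K k k≤n)) ⟩
    (Σ[ k < suc n ] S H k * (Σ[ j < suc (m + n) ] S (G ∪ K k) j * x ↓ j))
      ≡⟨ Σ-*-Σ-interchange (suc (m + n)) (suc n) (S H) (λ k j → S (G ∪ K k) j) (x ↓_) ⟩
    (Σ[ j < suc (m + n) ] (Σ[ k < suc n ] S H k * S (G ∪ K k) j) * x ↓ j) ∎
    where
    open ≡-Reasoning
    adjoin-K : ∀ k → k < suc n → chromatic G x * x ↓ k ≡ (Σ[ j < suc (m + n) ] S (G ∪ K k) j * x ↓ j)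
    adjoin-K k (s≤s k≤n) = begin
      chromatic G x * x ↓ k
        ≡⟨ cong (chromatic G x *_) (chromatic-K k x) ⟨
      chromatic G x * chromatic (K k) x
        ≡⟨ chromatic-∪ G (K k) x ⟨
      chromatic (G ∪ K k) x
        ≡⟨ chromatic-expansion (G ∪ K k) x (suc (m + n)) (s≤s (+-monoʳ-≤ m k≤n)) ⟩
      (Σ[ j < suc (m + n) ] S (G ∪ K k) j * x ↓ j) ∎

moment : ∀ {p} → Graph p → (ℕ → ℕ) → ℕ
moment {p} X w = Σ[ i < p ] S X (suc i) * w (suc i)

-- S H 0 reduces to 0 since H has a vertex, so the coefficient identity needs no k = 0 term.
moment-∪ : ∀ {m n} (G : Graph m) (H : Graph (suc n)) (w : ℕ → ℕ) →
           moment (G ∪ H) w ≡ (Σ[ k < suc n ] S H (suc k) * moment (G ∪ K (suc k)) w)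
moment-∪ {m} {n} G H w = begin
  (Σ[ i < m + suc n ] S (G ∪ H) (suc i) * w (suc i))
    ≡⟨ Σ-cong (m + suc n) (λ i i<m+n → cong (_* w (suc i)) (S-∪-coefficient G H (suc i) (s≤s i<m+n))) ⟩
  (Σ[ i < m + suc n ] (Σ[ k < suc n ] S H (suc k) * S (G ∪ K (suc k)) (suc i)) * w (suc i))
    ≡⟨ Σ-*-Σ-interchange (m + suc n) (suc n) (λ k → S H (suc k)) (λ k i → S (G ∪ K (suc k)) (suc i))
                         (λ i → w (suc i)) ⟨
  (Σ[ k < suc n ] S H (suc k) * (Σ[ i < m + suc n ] S (G ∪ K (suc k)) (suc i) * w (suc i)))
    ≡⟨ Σ-cong (suc n) (λ k k<n → cong (S H (suc k) *_) (Σ-truncate _ (+-monoʳ-≤ m k<n) λ i m+k<i →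
         cong (_* w (suc i)) (S-vanish (G ∪ K (suc k)) (suc i) (s≤s m+k<i)))) ⟩
  (Σ[ k < suc n ] S H (suc k) * moment (G ∪ K (suc k)) w) ∎
  where open ≡-Reasoning

𝓑≡moment : ∀ {p} (X : Graph p) → 𝓑 X ≡ moment X (λ _ → 1)
𝓑≡moment {p} X = trans (sum-applyUpTo p (S X) suc) (Σ-cong p λ i _ → sym (*-identityʳ (S X (suc i))))

𝓣≡moment : ∀ {p} (X : Graph p) → 𝓣 X ≡ moment X (λ j → j)
𝓣≡moment {p} X =
  trans (sum-applyUpTo p (λ k → k * S X k) suc) (Σ-cong p λ i _ → *-comm (suc i) (S X (suc i)))

lemma8 : {m n : ℕ} (G : Graph m) (H : Graph n) → IsSimple G → IsSimple H → 1 ≤ n →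
    (𝓑 (G ∪ H) ≡ sum (map (λ k → S H k * 𝓑 (G ∪ K k)) (applyUpTo suc n)))
    × (𝓣 (G ∪ H) ≡ sum (map (λ k → S H k * 𝓣 (G ∪ K k)) (applyUpTo suc n)))
lemma8 {m} {suc n} G H _ _ _ = via-moment 𝓑 (λ _ → 1) 𝓑≡moment , via-moment 𝓣 (λ j → j) 𝓣≡moment
  where
  open ≡-Reasoning
  via-moment : (F : ∀ {p} → Graph p → ℕ) (w : ℕ → ℕ) →
               (∀ {p} (X : Graph p) → F X ≡ moment X w) →
               F (G ∪ H) ≡ sum (map (λ k → S H k * F (G ∪ K k)) (applyUpTo suc (suc n)))
  via-moment F w F≡moment = begin
    F (G ∪ H)
      ≡⟨ F≡moment (G ∪ H) ⟩
    moment (G ∪ H) w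
      ≡⟨ moment-∪ G H w ⟩
    (Σ[ k < suc n ] S H (suc k) * moment (G ∪ K (suc k)) w)
      ≡⟨ Σ-cong (suc n) (λ k _ → cong (S H (suc k) *_) (F≡moment (G ∪ K (suc k)))) ⟨
    (Σ[ k < suc n ] S H (suc k) * F (G ∪ K (suc k)))
      ≡⟨ sum-applyUpTo (suc n) (λ k → S H k * F (G ∪ K k)) suc ⟨
    sum (map (λ k → S H k * F (G ∪ K k)) (applyUpTo suc (suc n))) ∎
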